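{- Let $k$ be a non-negative integer, $m$ a positive integer, and $\chi$ a Dirichlet character modulo $m$. Write $n\in\mathbb{N}$ as $n=\prod_{p^{c_p}\| n} p^{c_p}$ with $c_p\geq 1$, $p$ prime. Then: (i) $J_k(\chi;n)=n^k\prod_{p\mid n}\chi(p)^{c_p-1}\left(\chi(p)-\frac{1}{p^k}\right)$. (ii) If $\gcd(n,m)=1$, then $J_k(\chi;n)=n^k\chi(n)\prod_{p\mid n}\left(1-\frac{1}{\chi(p)p^k}\right)$. (iii) $J_k(\chi;\cdot)=\sum_{j=0}^{m-1}\chi(j)J_k^{j,m}$.
   Context: $\mu$ is the Möbius function. The Jordan-Dirichlet totient function is $J_k(\chi;n)=\sum_{d\mid n}\chi(d)d^k\mu(n/d)$ for $n\in\mathbb{N}$. For $j\in\{0,\dots,m-1\}$, the Jordan modulo totient function is $J_k^{j,m}(n)=\sum_{d\mid n,\ d\equiv j\pmod m}d^k\mu(n/d)$. Products over $p$ are over primes. The convention $0^0=1$ is used. -}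

module Defs where

open import Level using (Level; _⊔_) renaming (suc to lsuc)
open import Data.Nat as ℕ using (ℕ; zero; suc; _∸_)
open import Data.Nat.DivMod using (_/_; _%_)
open import Data.Nat.Divisibility using (_∣_; _∣?_)
open import Data.Nat.GCD using (gcd)
open import Data.Nat.Primality using (Prime; prime?)
open import Data.Integer as ℤ using (ℤ; +_; -[1+_])
open import Data.List using (List; []; _∷_; map; filter; foldr; length; upTo)
open import Data.Bool using (Bool; true; false; if_then_else_; _∧_)
open import Data.Product using (_×_)
open import Relation.Nullary using (¬_; does; ¬?)
open import Relation.Nullary.Decidable using (_×-dec_)
open import Relation.Binary.PropositionalEquality using (_≡_)
open import Algebra.Bundles using (CommutativeRing; Semiring)
import Algebra.Definitions.RawSemiring as RSDefs

-- A field of characteristic zero (e.g. ℂ), on top of stdlib's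
-- CommutativeRing bundle.  The inverse is a total function whose
-- behaviour is only specified on non-zero elements.

record CharZeroField (c ℓ : Level) : Set (lsuc (c ⊔ ℓ)) where
  field
    commutativeRing : CommutativeRing c ℓ
  open CommutativeRing commutativeRing public
  open RSDefs (Semiring.rawSemiring semiring) public using () renaming (_×_ to _·1_; _^_ to _^ᴿ_)
  field
    _⁻¹      : Carrier → Carrier
    inverseʳ : ∀ x → ¬ (x ≈ 0#) → (x * (x ⁻¹)) ≈ 1#
    1≉0      : ¬ (1# ≈ 0#)
    charZero : ∀ n → ¬ ((suc n ·1 1#) ≈ 0#)

  fromℕ : ℕ → Carrier
  fromℕ n = n ·1 1#

  fromℤ : ℤ → Carrier
  fromℤ (+ n)      = fromℕ n
  fromℤ (-[1+ n ]) = - fromℕ (suc n)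

  ∑ : List Carrier → Carrier
  ∑ = foldr _+_ 0#

  ∏ : List Carrier → Carrier
  ∏ = foldr _*_ 1#

record IsDirichletCharacter {c ℓ} (F : CharZeroField c ℓ) (m : ℕ)
                            (χ : ℕ → CharZeroField.Carrier F) : Set (c ⊔ ℓ) where
  open CharZeroField F
  field
    periodic       : ∀ a → χ (a ℕ.+ m) ≈ χ a
    multiplicative : ∀ a b → χ (a ℕ.* b) ≈ (χ a * χ b)
    one            : χ 1 ≈ 1#
    zero-iff       : ∀ a → (χ a ≈ 0# → ¬ (gcd a m ≡ 1)) × (¬ (gcd a m ≡ 1) → χ a ≈ 0#)

oneTo : ℕ → List ℕ
oneTo n = map suc (upTo n)

primeDivisors : ℕ → List ℕ
primeDivisors n = filter (λ p → prime? p ×-dec p ∣? n) (oneTo n)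

-- the exponent c_p of p in n (p^c_p ∥ n) for prime p and n ≥ 1:
-- the number of c ∈ {1,…,n} with p^c ∣ n
expo : ℕ → ℕ → ℕ
expo p n = length (filter (λ c → (p ℕ.^ c) ∣? n) (oneTo n))

squarefree : ℕ → Bool
squarefree n = foldr _∧_ true (map (λ d → does (¬? ((suc (suc d) ℕ.* suc (suc d)) ∣? n))) (upTo n))

-- Möbius function (μ(0) := 0, never used)
μ : ℕ → ℤ
μ zero    = + 0
μ (suc n) = if squarefree (suc n)
              then (ℤ.- (+ 1)) ℤ.^ length (primeDivisors (suc n))
              else + 0

module _ {c ℓ} (F : CharZeroField c ℓ) where
  open CharZeroField F

  divSum : ℕ → (ℕ → ℕ → Carrier) → Carrier
  divSum n f = ∑ (map (λ e → f (suc e) (n / suc e)) (filter (λ e → suc e ∣? n) (upTo n)))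

  J : (k : ℕ) (χ : ℕ → Carrier) (n : ℕ) → Carrier
  J k χ n = divSum n (λ d e → χ d * (fromℕ (d ℕ.^ k) * fromℤ (μ e)))

Jmod : (k j m : ℕ) .{{_ : ℕ.NonZero m}} (n : ℕ) → ℤ
Jmod k j m n =
  foldr ℤ._+_ (+ 0)
    (map (λ e → (+ (suc e ℕ.^ k)) ℤ.* μ (n / suc e))
         (filter (λ e → (suc e ∣? n) ×-dec ((suc e % m) ℕ.≟ j)) (upTo n)))

{-# OPTIONS --safe #-}
module Submission where

-- For a prime p and s ≥ 1, the divisors of p·s are the multiples p·y with y ∣ s, contributing
-- χ(p)p^k J_k(χ;s), and the divisors prime to p.  If p ∣ s the latter vanish, since p² divides the
-- argument of μ; if p ∤ s they are the divisors of s, with μ changing sign.  So J_k(χ;p·s) is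
-- χ(p)p^k J_k(χ;s) or (χ(p)p^k − 1) J_k(χ;s).  Both closed forms obey the same recursion and equal 1
-- at n = 1, which gives (i) and (ii) by induction on n; in (ii) the factor χ(p) is invertible, so
-- χ(p)p^k (1 − 1/(χ(p)p^k)) = χ(p)p^k − 1.  For (iii), group the divisors d of n by d mod m and use
-- χ(d) = χ(d mod m).

open import Defs
open import Data.Nat using (ℕ; _≤_; _^_; NonZero; _∸_)
open import Data.Nat.GCD using (gcd)
open import Data.List using (map; upTo)
open import Data.Product using (_×_; _,_)
open import Relation.Binary.PropositionalEquality using (_≡_)
open import Algebra.Bundles using (CommutativeMonoid)

module RangeSum {c ℓ} (M : CommutativeMonoid c ℓ) where

  open import Data.Nat as ℕ using (ℕ; zero; suc; _≤_; _<_; s≤s)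
  import Data.Nat.Properties as ℕP
  open import Data.Nat.Divisibility using (_∣?_; ∣m+n∣m⇒∣n; m∣m*n; ∣⇒≤)
  open import Data.List using (List; []; _∷_; map; filter; foldr; applyUpTo)
  open import Data.List.Properties using (map-applyUpTo)
  open import Data.Bool using (if_then_else_)
  open import Data.Product using (_,_)
  open import Data.Empty using (⊥-elim)
  open import Function using (_∘_)
  open import Relation.Nullary using (Dec; yes; no; does; ¬_)
  open import Relation.Unary using (Decidable)
  open import Relation.Binary.PropositionalEquality as ≡ using (_≡_; _≢_)

  open CommutativeMonoid M renaming (Carrier to A)
  open import Relation.Binary.Reasoning.Setoid setoid
  open import Algebra.Properties.CommutativeSemigroup commutativeSemigroup using (interchange)

  sumBelow : ℕ → (ℕ → A) → A
  sumBelow zero    g = ε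
  sumBelow (suc N) g = sumBelow N g ∙ g N

  when : {P : Set} → Dec P → A → A
  when d x = if does d then x else ε

  when-yes : {P : Set} {x : A} → P → (d : Dec P) → when d x ≈ x
  when-yes p (yes _) = refl
  when-yes p (no ¬p) = ⊥-elim (¬p p)

  when-no : {P : Set} {x : A} → ¬ P → (d : Dec P) → when d x ≈ ε
  when-no ¬p (yes p) = ⊥-elim (¬p p)
  when-no ¬p (no _)  = refl

  when-cong : {P Q : Set} {x y : A} (dP : Dec P) (dQ : Dec Q) →
              (P → Q) → (Q → P) → (Q → x ≈ y) → when dP x ≈ when dQ y
  when-cong (yes p) (yes q) _ _ x≈y = x≈y q
  when-cong (yes p) (no ¬q) P⇒Q _ _ = ⊥-elim (¬q (P⇒Q p))
  when-cong (no ¬p) (yes q) _ Q⇒P _ = ⊥-elim (¬p (Q⇒P q))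
  when-cong (no _)  (no _)  _ _ _   = refl

  when-⇔ : {P Q : Set} {x : A} (dP : Dec P) (dQ : Dec Q) → (P → Q) → (Q → P) → when dP x ≈ when dQ x
  when-⇔ dP dQ P⇒Q Q⇒P = when-cong dP dQ P⇒Q Q⇒P (λ _ → refl)

  sumBelow-cong : ∀ N {g h : ℕ → A} → (∀ e → e < N → g e ≈ h e) → sumBelow N g ≈ sumBelow N h
  sumBelow-cong zero    g≈h = refl
  sumBelow-cong (suc N) g≈h = ∙-cong (sumBelow-cong N (λ e e<N → g≈h e (ℕP.m≤n⇒m≤1+n e<N))) (g≈h N ℕP.≤-refl)

  sumBelow-ε : ∀ N (g : ℕ → A) → (∀ e → e < N → g e ≈ ε) → sumBelow N g ≈ ε
  sumBelow-ε N g g≈ε = trans (sumBelow-cong N g≈ε) (sumBelow-const-ε N)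
    where
    sumBelow-const-ε : ∀ N → sumBelow N (λ _ → ε) ≈ ε
    sumBelow-const-ε zero    = refl
    sumBelow-const-ε (suc N) = trans (identityʳ _) (sumBelow-const-ε N)

  sumBelow-sucˡ : ∀ N (g : ℕ → A) → sumBelow (suc N) g ≈ g 0 ∙ sumBelow N (g ∘ suc)
  sumBelow-sucˡ zero    g = trans (identityˡ _) (sym (identityʳ _))
  sumBelow-sucˡ (suc N) g = begin
    sumBelow (suc N) g ∙ g (suc N)           ≈⟨ ∙-congʳ (sumBelow-sucˡ N g) ⟩
    (g 0 ∙ sumBelow N (g ∘ suc)) ∙ g (suc N) ≈⟨ assoc _ _ _ ⟩
    g 0 ∙ sumBelow (suc N) (g ∘ suc)         ∎

  sumBelow-+ : ∀ N K (g : ℕ → A) → sumBelow (N ℕ.+ K) g ≈ sumBelow N g ∙ sumBelow K (λ e → g (N ℕ.+ e))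
  sumBelow-+ N zero g rewrite ℕP.+-identityʳ N = sym (identityʳ _)
  sumBelow-+ N (suc K) g rewrite ℕP.+-suc N K = begin
    sumBelow (N ℕ.+ K) g ∙ g (N ℕ.+ K)                                ≈⟨ ∙-congʳ (sumBelow-+ N K g) ⟩
    (sumBelow N g ∙ sumBelow K (λ e → g (N ℕ.+ e))) ∙ g (N ℕ.+ K)     ≈⟨ assoc _ _ _ ⟩
    sumBelow N g ∙ sumBelow (suc K) (λ e → g (N ℕ.+ e))               ∎

  sumBelow-extend : ∀ {N N'} (g : ℕ → A) → N ≤ N' → (∀ e → N ≤ e → e < N' → g e ≈ ε) →
                    sumBelow N' g ≈ sumBelow N g
  sumBelow-extend {N} g N≤N' vanish with ℕP.m≤n⇒∃[o]m+o≡n N≤N'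
  ... | K , ≡.refl = begin
    sumBelow (N ℕ.+ K) g                          ≈⟨ sumBelow-+ N K g ⟩
    sumBelow N g ∙ sumBelow K (λ e → g (N ℕ.+ e)) ≈⟨ ∙-congˡ (sumBelow-ε K _ (λ e e<K →
                                                       vanish (N ℕ.+ e) (ℕP.m≤m+n N e) (ℕP.+-monoʳ-< N e<K))) ⟩
    sumBelow N g ∙ ε                              ≈⟨ identityʳ _ ⟩
    sumBelow N g                                  ∎

  sumBelow-shift : ∀ n {N} (g : ℕ → A) → g 0 ≈ ε → n < N → (∀ e → n < e → e < N → g e ≈ ε) →
                   sumBelow N g ≈ sumBelow n (g ∘ suc)
  sumBelow-shift n {N} g g0≈ε n<N vanish = begin
    sumBelow N g                  ≈⟨ sumBelow-extend g n<N vanish ⟩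
    sumBelow (suc n) g            ≈⟨ sumBelow-sucˡ n g ⟩
    g 0 ∙ sumBelow n (g ∘ suc)    ≈⟨ ∙-congʳ g0≈ε ⟩
    ε ∙ sumBelow n (g ∘ suc)      ≈⟨ identityˡ _ ⟩
    sumBelow n (g ∘ suc)          ∎

  sumBelow-∙ : ∀ N (g h : ℕ → A) → sumBelow N (λ e → g e ∙ h e) ≈ sumBelow N g ∙ sumBelow N h
  sumBelow-∙ zero    g h = sym (identityˡ ε)
  sumBelow-∙ (suc N) g h = trans (∙-congʳ (sumBelow-∙ N g h)) (interchange _ _ _ _)

  sumBelow-swap : ∀ N K (G : ℕ → ℕ → A) →
                  sumBelow N (λ e → sumBelow K (G e)) ≈ sumBelow K (λ j → sumBelow N (λ e → G e j))
  sumBelow-swap N zero    G = sumBelow-ε N _ (λ _ _ → refl)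
  sumBelow-swap N (suc K) G = trans (sumBelow-∙ N _ _) (∙-congʳ (sumBelow-swap N K G))

  sumBelow-factorAt : ∀ N p x (a b : ℕ → A) → p < N → (∀ e → e < N → e ≢ p → a e ≈ b e) →
                      a p ≈ x ∙ b p → sumBelow N a ≈ x ∙ sumBelow N b
  sumBelow-factorAt (suc N) p x a b p<N a≈b aₚ≈xbₚ with p ℕ.≟ N
  ... | yes ≡.refl = begin
    sumBelow N a ∙ a p     ≈⟨ ∙-cong (sumBelow-cong N (λ e e<N → a≈b e (ℕP.m≤n⇒m≤1+n e<N) (ℕP.<⇒≢ e<N))) aₚ≈xbₚ ⟩
    sumBelow N b ∙ (x ∙ b p) ≈⟨ comm _ _ ⟩
    (x ∙ b p) ∙ sumBelow N b ≈⟨ assoc _ _ _ ⟩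
    x ∙ (b p ∙ sumBelow N b) ≈⟨ ∙-congˡ (comm _ _) ⟩
    x ∙ sumBelow (suc N) b   ∎
  ... | no p≢N = begin
    sumBelow N a ∙ a N       ≈⟨ ∙-cong (sumBelow-factorAt N p x a b (ℕP.≤∧≢⇒< (ℕP.≤-pred p<N) p≢N)
                                         (λ e e<N → a≈b e (ℕP.m≤n⇒m≤1+n e<N)) aₚ≈xbₚ)
                                       (a≈b N ℕP.≤-refl (p≢N ∘ ≡.sym)) ⟩
    (x ∙ sumBelow N b) ∙ b N ≈⟨ assoc _ _ _ ⟩
    x ∙ sumBelow (suc N) b   ∎

  sumBelow-delta : ∀ K a (x : A) → a < K → sumBelow K (λ j → when (a ℕ.≟ j) x) ≈ x
  sumBelow-delta K a x a<K = begin
    sumBelow K (λ j → when (a ℕ.≟ j) x) ≈⟨ sumBelow-factorAt K a x _ (λ _ → ε) a<K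
                                             (λ e _ e≢a → when-no (e≢a ∘ ≡.sym) (a ℕ.≟ e))
                                             (trans (when-yes ≡.refl (a ℕ.≟ a)) (sym (identityʳ x))) ⟩
    x ∙ sumBelow K (λ _ → ε)            ≈⟨ ∙-congˡ (sumBelow-ε K _ (λ _ _ → refl)) ⟩
    x ∙ ε                               ≈⟨ identityʳ x ⟩
    x                                   ∎

  sumBelow-multiples : ∀ p M (h : ℕ → A) → 1 ≤ p →
                       sumBelow (p ℕ.* M) (λ x → when (p ∣? x) (h x)) ≈ sumBelow M (λ y → h (p ℕ.* y))
  sumBelow-multiples p zero h _ rewrite ℕP.*-zeroʳ p = refl
  sumBelow-multiples p@(suc p-1) (suc M) h 1≤p = begin
    sumBelow (p ℕ.* suc M) g                                      ≡⟨ ≡.cong (λ z → sumBelow z g) pM+p ⟩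
    sumBelow (p ℕ.* M ℕ.+ p) g                                    ≈⟨ sumBelow-+ (p ℕ.* M) p g ⟩
    sumBelow (p ℕ.* M) g ∙ sumBelow p (λ e → g (p ℕ.* M ℕ.+ e))   ≈⟨ ∙-cong (sumBelow-multiples p M h 1≤p) (sumBelow-sucˡ p-1 _) ⟩
    sumBelow M (λ y → h (p ℕ.* y)) ∙ (g (p ℕ.* M ℕ.+ 0) ∙ sumBelow p-1 (λ e → g (p ℕ.* M ℕ.+ suc e)))
                                                                  ≈⟨ ∙-congˡ (∙-cong multiple (sumBelow-ε p-1 _ nonMultiple)) ⟩
    sumBelow M (λ y → h (p ℕ.* y)) ∙ (h (p ℕ.* M) ∙ ε)            ≈⟨ ∙-congˡ (identityʳ _) ⟩
    sumBelow (suc M) (λ y → h (p ℕ.* y))                          ∎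
    where
    pM+p : p ℕ.* suc M ≡ p ℕ.* M ℕ.+ p
    pM+p = ≡.trans (ℕP.*-suc p M) (ℕP.+-comm p (p ℕ.* M))
    g : ℕ → A
    g x = when (p ∣? x) (h x)
    multiple : g (p ℕ.* M ℕ.+ 0) ≈ h (p ℕ.* M)
    multiple rewrite ℕP.+-identityʳ (p ℕ.* M) = when-yes (m∣m*n M) (p ∣? (p ℕ.* M))
    nonMultiple : ∀ e → e < p-1 → g (p ℕ.* M ℕ.+ suc e) ≈ ε
    nonMultiple e e<p-1 = when-no (λ p∣ → ℕP.<-irrefl ≡.refl
      (ℕP.≤-trans (s≤s e<p-1) (∣⇒≤ (∣m+n∣m⇒∣n p∣ (m∣m*n M))))) (p ∣? (p ℕ.* M ℕ.+ suc e))

  fold : List A → A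
  fold = foldr _∙_ ε

  fold-applyUpTo : ∀ N (g : ℕ → A) → fold (applyUpTo g N) ≈ sumBelow N g
  fold-applyUpTo zero    g = refl
  fold-applyUpTo (suc N) g = trans (∙-congˡ (fold-applyUpTo N (g ∘ suc))) (sym (sumBelow-sucˡ N g))

  fold-filter : ∀ {B : Set} {Q : B → Set} (Q? : Decidable Q) (g : B → A) (xs : List B) →
                fold (map g (filter Q? xs)) ≈ fold (map (λ x → when (Q? x) (g x)) xs)
  fold-filter Q? g []       = refl
  fold-filter Q? g (x ∷ xs) with Q? x
  ... | yes _ = ∙-congˡ (fold-filter Q? g xs)
  ... | no _  = trans (fold-filter Q? g xs) (sym (identityˡ _))

  fold-filter-applyUpTo : ∀ {Q : ℕ → Set} (Q? : Decidable Q) N (h : ℕ → ℕ) (g : ℕ → A) →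
    fold (map g (filter Q? (applyUpTo h N))) ≈ sumBelow N (λ e → when (Q? (h e)) (g (h e)))
  fold-filter-applyUpTo Q? N h g = begin
    fold (map g (filter Q? (applyUpTo h N)))                   ≈⟨ fold-filter Q? g (applyUpTo h N) ⟩
    fold (map (λ x → when (Q? x) (g x)) (applyUpTo h N))       ≡⟨ ≡.cong fold (map-applyUpTo h _ N) ⟩
    fold (applyUpTo (λ e → when (Q? (h e)) (g (h e))) N)       ≈⟨ fold-applyUpTo N _ ⟩
    sumBelow N (λ e → when (Q? (h e)) (g (h e)))               ∎

module NatArithmetic where

  open import Data.Nat as ℕ using (ℕ; zero; suc; _+_; _*_; _^_; _≤_; _<_; z≤n; s≤s; NonZero)
  import Data.Nat.Properties as ℕP
  open import Data.Nat.Divisibility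
  open import Data.Nat.Primality
  open import Data.Nat.Primality.Factorisation using (factorise)
  open import Data.Nat.Coprimality using (Coprime; coprime-divisor; coprime⇒gcd≡1; gcd≡1⇒coprime)
  open import Data.Nat.DivMod using (m*n/n≡m)
  open import Data.Nat.GCD using (gcd)
  open import Data.Nat.Induction using (<-rec)
  open import Data.Nat.ListAction using (product)
  open import Data.List using ([]; _∷_)
  open import Data.List.Relation.Unary.All using (_∷_)
  open import Data.Product using (_,_; _×_; ∃)
  open import Data.Sum using (inj₁; inj₂)
  open import Data.Empty using (⊥-elim)
  open import Relation.Nullary using (¬_)
  open import Relation.Binary.PropositionalEquality
  open import Algebra.Properties.CommutativeSemigroup ℕP.*-commutativeSemigroup using (interchange)

  prime⇒≥2 : ∀ {p} → Prime p → 2 ≤ p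
  prime⇒≥2 {p} pp = ℕ.nonTrivial⇒n>1 p {{prime⇒nonTrivial pp}}

  prime⇒≥1 : ∀ {p} → Prime p → 1 ≤ p
  prime⇒≥1 pp = ℕP.≤-trans (s≤s z≤n) (prime⇒≥2 pp)

  ≥1⇒nonZero : ∀ {n} → 1 ≤ n → NonZero n
  ≥1⇒nonZero {suc n} _ = _

  ∣⇒≤′ : ∀ {m n} → 1 ≤ n → m ∣ n → m ≤ n
  ∣⇒≤′ 1≤n = ∣⇒≤ {{≥1⇒nonZero 1≤n}}

  n≤prime*n : ∀ {p} n → Prime p → n ≤ p * n
  n≤prime*n {p} n pp = ℕP.m≤n*m n p {{prime⇒nonZero pp}}

  n<prime*n : ∀ {p n} → Prime p → 1 ≤ n → n < p * n
  n<prime*n {p} {n} pp 1≤n = subst (n <_) (ℕP.*-comm n p) (ℕP.m<m*n n p {{≥1⇒nonZero 1≤n}} (prime⇒≥2 pp))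

  1≤prime*n : ∀ {p n} → Prime p → 1 ≤ n → 1 ≤ p * n
  1≤prime*n {n = n} pp 1≤n = ℕP.≤-trans 1≤n (n≤prime*n n pp)

  ≥1-factorʳ : ∀ {m n o} → 1 ≤ o → o ≡ m * n → 1 ≤ n
  ≥1-factorʳ {m} {zero}  1≤o o≡mn = ⊥-elim (ℕP.<-irrefl (sym (trans o≡mn (ℕP.*-zeroʳ m))) 1≤o)
  ≥1-factorʳ {m} {suc n} _ _     = s≤s z≤n

  ≥1-factorˡ : ∀ {m n o} → 1 ≤ o → o ≡ m * n → 1 ≤ m
  ≥1-factorˡ {m} {n} 1≤o o≡mn = ≥1-factorʳ {n} {m} 1≤o (trans o≡mn (ℕP.*-comm m n))

  n<q^n : ∀ {q} → 2 ≤ q → ∀ n → n < q ^ n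
  n<q^n 2≤q zero    = s≤s z≤n
  n<q^n {q} 2≤q (suc n) = begin-strict
    suc n               <⟨ ℕP.m<n+m (suc n) (s≤s z≤n) ⟩
    suc n + suc n       ≡⟨ cong (suc n +_) (sym (ℕP.+-identityʳ (suc n))) ⟩
    2 * suc n           ≤⟨ ℕP.*-mono-≤ 2≤q (n<q^n 2≤q n) ⟩
    q * q ^ n           ∎
    where open ℕP.≤-Reasoning

  *-^ : ∀ a b k → (a * b) ^ k ≡ a ^ k * b ^ k
  *-^ a b zero    = refl
  *-^ a b (suc k) = trans (cong ((a * b) *_) (*-^ a b k)) (interchange a b (a ^ k) (b ^ k))

  ∃primeDivisor : ∀ {n} → 2 ≤ n → ∃ λ p → Prime p × p ∣ n
  ∃primeDivisor {n@(suc _)} 2≤n with factorise n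
  ... | record { factors = [] ; isFactorisation = n≡1 } = ⊥-elim (ℕP.<-irrefl (sym n≡1) 2≤n)
  ... | record { factors = p ∷ ps ; isFactorisation = n≡∏ ; factorsPrime = pp ∷ _ } =
    p , pp , subst (p ∣_) (sym n≡∏) (m∣m*n (product ps))

  prime∤⇒∣ʳ : ∀ {q a b} → Prime q → ¬ q ∣ a → q ∣ a * b → q ∣ b
  prime∤⇒∣ʳ {a = a} {b} pq q∤a q∣ab with euclidsLemma a b pq q∣ab
  ... | inj₁ q∣a = ⊥-elim (q∤a q∣a)
  ... | inj₂ q∣b = q∣b

  prime∤⇒coprime : ∀ {p d} → Prime p → ¬ p ∣ d → Coprime d p
  prime∤⇒coprime pp p∤d (i∣d , i∣p) with prime⇒irreducible pp i∣p
  ... | inj₁ i≡1 = i≡1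
  ... | inj₂ refl = ⊥-elim (p∤d i∣d)

  ∣prime*⇒∣ : ∀ {p d m} → Prime p → ¬ p ∣ d → d ∣ p * m → d ∣ m
  ∣prime*⇒∣ pp p∤d = coprime-divisor (prime∤⇒coprime pp p∤d)

  prime^∤⇒∣ʳ : ∀ {q a} → Prime q → ¬ q ∣ a → ∀ j b → q ^ j ∣ a * b → q ^ j ∣ b
  prime^∤⇒∣ʳ pq q∤a zero    b _ = 1∣ b
  prime^∤⇒∣ʳ {q} {a} pq q∤a (suc j) b q^j∣ab with prime∤⇒∣ʳ pq q∤a (∣-trans (m∣m*n (q ^ j)) q^j∣ab)
  ... | divides t refl = subst (q ^ suc j ∣_) (ℕP.*-comm q t) (*-monoʳ-∣ q (prime^∤⇒∣ʳ pq q∤a j t q^j∣at))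
    where
    instance _ = prime⇒nonZero pq
    q^j∣at : q ^ j ∣ a * t
    q^j∣at = *-cancelˡ-∣ q (subst (q * q ^ j ∣_) (trans (sym (ℕP.*-assoc a t q)) (ℕP.*-comm (a * t) q)) q^j∣ab)

  distinctPrimes-∤ : ∀ {p q} → Prime p → Prime q → q ≢ p → ¬ q ∣ p
  distinctPrimes-∤ pp pq q≢p q∣p with prime⇒irreducible pp q∣p
  ... | inj₁ refl = ¬prime[1] pq
  ... | inj₂ q≡p  = q≢p q≡p

  -- Total division with junk value n ÷ 0 = 0; unlike _/_ it needs no NonZero instance for a variable divisor.
  _÷_ : ℕ → ℕ → ℕ
  n ÷ zero  = 0
  n ÷ suc d = n ℕ./ suc d

  ÷-cancel : ∀ {n t d} → 1 ≤ d → n ≡ t * d → n ÷ d ≡ t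
  ÷-cancel {t = t} {suc d} _ refl = m*n/n≡m t (suc d)

  primeInduction : ∀ {ℓ} (P : ℕ → Set ℓ) → P 1 → (∀ {p s} → Prime p → 1 ≤ s → P s → P (p * s)) → ∀ n → 1 ≤ n → P n
  primeInduction P P1 step = <-rec (λ n → 1 ≤ n → P n) go
    where
    go : ∀ n → (∀ {m} → m < n → 1 ≤ m → P m) → 1 ≤ n → P n
    go 1                ih _   = P1
    go n@(suc (suc _))  ih 1≤n with ∃primeDivisor {n} (s≤s (s≤s z≤n))
    ... | p , pp , divides s n≡sp = subst P (sym n≡ps) (step pp 1≤s (ih s<n 1≤s))
      where
      n≡ps : n ≡ p * s
      n≡ps = trans n≡sp (ℕP.*-comm s p)
      1≤s : 1 ≤ s
      1≤s = ≥1-factorʳ {p} 1≤n n≡ps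
      s<n : s < n
      s<n = subst (s <_) (sym n≡ps) (n<prime*n pp 1≤s)

  gcd≡1-∣ : ∀ {d a m} → d ∣ a → gcd a m ≡ 1 → gcd d m ≡ 1
  gcd≡1-∣ {d} {a} {m} d∣a gcd≡1 = coprime⇒gcd≡1 (λ (i∣d , i∣m) → gcd≡1⇒coprime {a} {m} gcd≡1 (∣-trans i∣d d∣a , i∣m))

open NatArithmetic

module PrimeDivisorFold {c ℓ} (M : CommutativeMonoid c ℓ) where

  open import Data.Nat using (ℕ; suc; _*_; _≤_; _<_; s≤s)
  import Data.Nat.Properties as ℕP
  open import Data.Nat.Divisibility
  open import Data.Nat.Primality
  open import Data.List using (map; filter; applyUpTo; upTo)
  open import Data.List.Properties using (map-applyUpTo)
  open import Data.Product using (_,_; _×_; proj₂)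
  open import Function using (id)
  open import Relation.Nullary using (Dec)
  open import Relation.Nullary.Decidable using (_×-dec_)
  open import Relation.Binary.PropositionalEquality as ≡ using (_≡_; _≢_)

  open CommutativeMonoid M renaming (Carrier to A)
  open RangeSum M
  open import Relation.Binary.Reasoning.Setoid setoid

  isPrimeDivisor? : ∀ n q → Dec (Prime q × q ∣ n)
  isPrimeDivisor? n q = prime? q ×-dec q ∣? n

  fold-primeDivisors : ∀ {n N} (g : ℕ → A) → 1 ≤ n → n < N →
    fold (map g (primeDivisors n)) ≈ sumBelow N (λ q → when (isPrimeDivisor? n q) (g q))
  fold-primeDivisors {n} {N} g 1≤n n<N = begin
    fold (map g (filter (isPrimeDivisor? n) (map suc (upTo n))))
      ≡⟨ ≡.cong (λ qs → fold (map g (filter (isPrimeDivisor? n) qs))) (map-applyUpTo id suc n) ⟩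
    fold (map g (filter (isPrimeDivisor? n) (applyUpTo suc n)))
      ≈⟨ fold-filter-applyUpTo (isPrimeDivisor? n) n suc g ⟩
    sumBelow n (λ e → when (isPrimeDivisor? n (suc e)) (g (suc e)))
      ≈⟨ sym (sumBelow-shift n G (when-no {x = g 0} (λ (p0 , _) → ¬prime[0] p0) (isPrimeDivisor? n 0)) n<N
                (λ e n<e _ → when-no {x = g e} (λ (_ , e∣n) → ℕP.<⇒≱ n<e (∣⇒≤′ 1≤n e∣n)) (isPrimeDivisor? n e))) ⟩
    sumBelow N G ∎
    where
    G : ℕ → A
    G q = when (isPrimeDivisor? n q) (g q)

  fold-primeDivisors-prime* : ∀ {p s} (g g' : ℕ → A) x → Prime p → 1 ≤ s →
    (∀ q → Prime q → q ∣ s → q ≢ p → g q ≈ g' q) → g p ≈ x ∙ when (p ∣? s) (g' p) →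
    fold (map g (primeDivisors (p * s))) ≈ x ∙ fold (map g' (primeDivisors s))
  fold-primeDivisors-prime* {p} {s} g g' x pp 1≤s agree atp = begin
    fold (map g (primeDivisors (p * s)))            ≈⟨ fold-primeDivisors g (1≤prime*n pp 1≤s) (ℕP.n<1+n _) ⟩
    sumBelow N (λ q → when (isPrimeDivisor? (p * s) q) (g q))
      ≈⟨ sumBelow-factorAt N p x _ _ (s≤s (ℕP.m≤m*n p s {{≥1⇒nonZero 1≤s}})) away at ⟩
    x ∙ sumBelow N (λ q → when (isPrimeDivisor? s q) (g' q))
      ≈⟨ ∙-congˡ (sym (fold-primeDivisors g' 1≤s (s≤s (n≤prime*n s pp)))) ⟩
    x ∙ fold (map g' (primeDivisors s))            ∎
    where
    N = suc (p * s)
    away : ∀ q → q < N → q ≢ p → when (isPrimeDivisor? (p * s) q) (g q) ≈ when (isPrimeDivisor? s q) (g' q)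
    away q _ q≢p = when-cong (isPrimeDivisor? (p * s) q) (isPrimeDivisor? s q)
      (λ (pq , q∣ps) → pq , prime∤⇒∣ʳ pq (distinctPrimes-∤ pp pq q≢p) q∣ps)
      (λ (pq , q∣s) → pq , ∣-trans q∣s (n∣m*n p))
      (λ (pq , q∣s) → agree q pq q∣s q≢p)
    at : when (isPrimeDivisor? (p * s) p) (g p) ≈ x ∙ when (isPrimeDivisor? s p) (g' p)
    at = trans (when-yes (pp , m∣m*n s) (isPrimeDivisor? (p * s) p))
               (trans atp (∙-congˡ (when-⇔ (p ∣? s) (isPrimeDivisor? s p) (pp ,_) proj₂)))

module ArithmeticFunctions where

  open import Data.Nat as ℕ using (ℕ; suc; _+_; _*_; _^_; _≤_; _<_; z≤n; s≤s)
  import Data.Nat.Properties as ℕP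
  open import Data.Nat.Divisibility
  open import Data.Nat.Primality
  open import Data.Integer as ℤ using (ℤ; +_)
  import Data.Integer.Properties as ℤP
  open import Data.List using (List; []; _∷_; map; filter; foldr; applyUpTo; upTo; length)
  open import Data.List.Properties using (map-applyUpTo)
  open import Data.List.Relation.Unary.All using (All; []; _∷_)
  open import Data.List.Relation.Unary.All.Properties using (map⁻; map⁺; applyUpTo⁻; applyUpTo⁺₁)
  open import Data.Bool using (true; false; T; _∧_; if_then_else_)
  open import Data.Bool.Properties using (T-∧)
  open import Data.Product using (_,_; proj₁; proj₂)
  open import Data.Empty using (⊥-elim)
  open import Function using (id; Equivalence)
  open import Relation.Nullary using (¬_; Dec; yes; no; does; ¬?)
  open import Relation.Binary.PropositionalEquality as ≡ using (_≡_; refl)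

  module ℕ+ = RangeSum ℕP.+-0-commutativeMonoid
  open ℕ+ using (sumBelow; when; when-yes; when-no; when-⇔)

  length≡fold : ∀ {A : Set} (xs : List A) → length xs ≡ ℕ+.fold (map (λ _ → 1) xs)
  length≡fold []       = refl
  length≡fold (x ∷ xs) = ≡.cong suc (length≡fold xs)

  expo≡sumBelow : ∀ q n → expo q n ≡ sumBelow n (λ e → when (q ^ suc e ∣? n) 1)
  expo≡sumBelow q n = begin
    length (filter (λ c → q ^ c ∣? n) (map suc (upTo n)))
      ≡⟨ ≡.cong (λ cs → length (filter (λ c → q ^ c ∣? n) cs)) (map-applyUpTo id suc n) ⟩
    length (filter (λ c → q ^ c ∣? n) (applyUpTo suc n))
      ≡⟨ length≡fold (filter (λ c → q ^ c ∣? n) (applyUpTo suc n)) ⟩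
    ℕ+.fold (map (λ _ → 1) (filter (λ c → q ^ c ∣? n) (applyUpTo suc n)))
      ≡⟨ ℕ+.fold-filter-applyUpTo (λ c → q ^ c ∣? n) n suc (λ _ → 1) ⟩
    sumBelow n (λ e → when (q ^ suc e ∣? n) 1) ∎
    where open ≡.≡-Reasoning

  q^e∤n : ∀ {q n e} → 2 ≤ q → 1 ≤ n → n ≤ e → ¬ q ^ e ∣ n
  q^e∤n 2≤q 1≤n n≤e q^e∣n = ℕP.<⇒≱ (ℕP.≤-<-trans n≤e (n<q^n 2≤q _)) (∣⇒≤′ 1≤n q^e∣n)

  expo-∤ : ∀ {q n} → ¬ q ∣ n → expo q n ≡ 0
  expo-∤ {q} {n} q∤n = ≡.trans (expo≡sumBelow q n)
    (ℕ+.sumBelow-ε n _ (λ e _ → when-no (λ q^e∣n → q∤n (∣-trans (m∣m*n (q ^ e)) q^e∣n)) (q ^ suc e ∣? n)))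

  expo-coprime* : ∀ {q a n} → Prime q → ¬ q ∣ a → 1 ≤ a → 1 ≤ n → expo q (a * n) ≡ expo q n
  expo-coprime* {q} {a} {n} pq q∤a 1≤a 1≤n = begin
    expo q (a * n)                                  ≡⟨ expo≡sumBelow q (a * n) ⟩
    sumBelow (a * n) (λ e → when (q ^ suc e ∣? (a * n)) 1)
      ≡⟨ ℕ+.sumBelow-cong (a * n) (λ e _ → when-⇔ (q ^ suc e ∣? (a * n)) (q ^ suc e ∣? n)
                                             (prime^∤⇒∣ʳ pq q∤a (suc e) n) (λ q^e∣n → ∣-trans q^e∣n (n∣m*n a))) ⟩
    sumBelow (a * n) (λ e → when (q ^ suc e ∣? n) 1)
      ≡⟨ ℕ+.sumBelow-extend _ (ℕP.m≤n*m n a {{≥1⇒nonZero 1≤a}})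
           (λ e n≤e _ → when-no (q^e∤n (prime⇒≥2 pq) 1≤n (ℕP.m≤n⇒m≤1+n n≤e)) (q ^ suc e ∣? n)) ⟩
    sumBelow n (λ e → when (q ^ suc e ∣? n) 1)      ≡⟨ ≡.sym (expo≡sumBelow q n) ⟩
    expo q n                                        ∎
    where open ≡.≡-Reasoning

  expo-prime* : ∀ {q n} → Prime q → 1 ≤ n → expo q (q * n) ≡ suc (expo q n)
  expo-prime* {q} {n} pq 1≤n = begin
    expo q (q * n)                                         ≡⟨ expo≡sumBelow q (q * n) ⟩
    sumBelow (q * n) (λ e → when (q ^ suc e ∣? (q * n)) 1)
      ≡⟨ ℕ+.sumBelow-cong (q * n) (λ e _ → when-⇔ (q ^ suc e ∣? (q * n)) (q ^ e ∣? n) (*-cancelˡ-∣ q) (*-monoʳ-∣ q)) ⟩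
    sumBelow (q * n) (λ e → when (q ^ e ∣? n) 1)
      ≡⟨ ℕ+.sumBelow-extend _ (n<prime*n pq 1≤n) (λ e n<e _ → when-no (q^e∤n (prime⇒≥2 pq) 1≤n (ℕP.<⇒≤ n<e)) (q ^ e ∣? n)) ⟩
    sumBelow (suc n) (λ e → when (q ^ e ∣? n) 1)           ≡⟨ ℕ+.sumBelow-sucˡ n _ ⟩
    when (q ^ 0 ∣? n) 1 + sumBelow n (λ e → when (q ^ suc e ∣? n) 1)
      ≡⟨ ≡.cong₂ _+_ (when-yes (1∣ n) (q ^ 0 ∣? n)) (≡.sym (expo≡sumBelow q n)) ⟩
    suc (expo q n)                                         ∎
    where
    open ≡.≡-Reasoning
    instance _ = prime⇒nonZero pq

  length-primeDivisors-prime* : ∀ {p s} → Prime p → ¬ p ∣ s → 1 ≤ s →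
    length (primeDivisors (p * s)) ≡ suc (length (primeDivisors s))
  length-primeDivisors-prime* {p} {s} pp p∤s 1≤s = begin
    length (primeDivisors (p * s))                       ≡⟨ length≡fold (primeDivisors (p * s)) ⟩
    ℕ+.fold (map (λ _ → 1) (primeDivisors (p * s)))      ≡⟨ fold-primeDivisors-prime* _ _ 1 pp 1≤s (λ _ _ _ _ → refl)
                                                              (≡.cong suc (≡.sym (when-no p∤s (p ∣? s)))) ⟩
    suc (ℕ+.fold (map (λ _ → 1) (primeDivisors s)))      ≡⟨ ≡.cong suc (≡.sym (length≡fold (primeDivisors s))) ⟩
    suc (length (primeDivisors s))                       ∎
    where
    open ≡.≡-Reasoning
    open PrimeDivisorFold ℕP.+-0-commutativeMonoid using (fold-primeDivisors-prime*)

  SquareFree : ℕ → Set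
  SquareFree n = ∀ d → 2 ≤ d → ¬ d * d ∣ n

  T-and⁻ : ∀ bs → T (foldr _∧_ true bs) → All T bs
  T-and⁻ []       _ = []
  T-and⁻ (_ ∷ bs) t = proj₁ (Equivalence.to T-∧ t) ∷ T-and⁻ bs (proj₂ (Equivalence.to T-∧ t))

  T-and⁺ : ∀ {bs} → All T bs → T (foldr _∧_ true bs)
  T-and⁺ []         = _
  T-and⁺ (tb ∷ tbs) = Equivalence.from T-∧ (tb , T-and⁺ tbs)

  T-⇔⇒≡ : ∀ {a b} → (T a → T b) → (T b → T a) → a ≡ b
  T-⇔⇒≡ {true}  {true}  _ _ = refl
  T-⇔⇒≡ {true}  {false} f _ = ⊥-elim (f _)
  T-⇔⇒≡ {false} {true}  _ g = ⊥-elim (g _)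
  T-⇔⇒≡ {false} {false} _ _ = refl

  T-does-¬⇒¬ : ∀ {P : Set} (D : Dec P) → T (does (¬? D)) → ¬ P
  T-does-¬⇒¬ (no ¬p) _ = ¬p

  ¬⇒T-does-¬ : ∀ {P : Set} (D : Dec P) → ¬ P → T (does (¬? D))
  ¬⇒T-does-¬ (yes p) ¬p = ¬p p
  ¬⇒T-does-¬ (no _)  _  = _

  squarefree⇒SquareFree : ∀ {n} → 1 ≤ n → T (squarefree n) → SquareFree n
  squarefree⇒SquareFree {n} 1≤n t d@(suc (suc e)) _ d²∣n =
    T-does-¬⇒¬ (d * d ∣? n) (applyUpTo⁻ _ n (map⁻ (T-and⁻ _ t)) e<n) d²∣n
    where
    e<n : e < n
    e<n = ℕP.≤-trans (ℕP.n≤1+n (suc e)) (ℕP.≤-trans (ℕP.m≤m*n d d) (∣⇒≤′ 1≤n d²∣n))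
  squarefree⇒SquareFree _ _ 1 (s≤s ()) _

  SquareFree⇒squarefree : ∀ {n} → SquareFree n → T (squarefree n)
  SquareFree⇒squarefree {n} sf = T-and⁺ (map⁺ (applyUpTo⁺₁ id n (λ {e} _ →
    ¬⇒T-does-¬ (suc (suc e) * suc (suc e) ∣? n) (sf (suc (suc e)) (s≤s (s≤s z≤n))))))

  SquareFree-prime* : ∀ {p s} → Prime p → ¬ p ∣ s → SquareFree s → SquareFree (p * s)
  SquareFree-prime* {p} {s} pp p∤s sf d 2≤d d²∣ps with ∃primeDivisor 2≤d
  ... | q , pq , q∣d with q ℕ.≟ p
  ...   | yes refl = p∤s (*-cancelˡ-∣ p {{prime⇒nonZero pp}} (∣-trans (*-pres-∣ q∣d q∣d) d²∣ps))
  ...   | no q≢p   = sf q (prime⇒≥2 pq) q²∣s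
    where
    q²∣s : q * q ∣ s
    q²∣s = ≡.subst (_∣ s) (≡.cong (q *_) (ℕP.*-identityʳ q))
             (prime^∤⇒∣ʳ pq (distinctPrimes-∤ pp pq q≢p) 2 s
               (≡.subst (_∣ p * s) (≡.cong (q *_) (≡.sym (ℕP.*-identityʳ q))) (∣-trans (*-pres-∣ q∣d q∣d) d²∣ps)))

  μ-unfold : ∀ {n} → 1 ≤ n → μ n ≡ (if squarefree n then (ℤ.- (+ 1)) ℤ.^ length (primeDivisors n) else + 0)
  μ-unfold {suc n} _ = refl

  μ-square : ∀ {n} d → 1 ≤ n → 2 ≤ d → d * d ∣ n → μ n ≡ + 0
  μ-square {n} d 1≤n 2≤d d²∣n rewrite μ-unfold 1≤n with squarefree n in sf
  ... | true  = ⊥-elim (squarefree⇒SquareFree 1≤n (≡.subst T (≡.sym sf) _) d 2≤d d²∣n)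
  ... | false = refl

  squarefree-prime* : ∀ {p s} → Prime p → ¬ p ∣ s → 1 ≤ s → squarefree (p * s) ≡ squarefree s
  squarefree-prime* {p} pp p∤s 1≤s = T-⇔⇒≡
    (λ t → SquareFree⇒squarefree (λ d 2≤d d²∣s → squarefree⇒SquareFree (1≤prime*n pp 1≤s) t d 2≤d (∣-trans d²∣s (n∣m*n p))))
    (λ t → SquareFree⇒squarefree (SquareFree-prime* pp p∤s (squarefree⇒SquareFree 1≤s t)))

  μ-prime* : ∀ {p s} → Prime p → ¬ p ∣ s → 1 ≤ s → μ (p * s) ≡ ℤ.- μ s
  μ-prime* {p} {s} pp p∤s 1≤s
    rewrite μ-unfold (1≤prime*n pp 1≤s) | μ-unfold 1≤s | length-primeDivisors-prime* pp p∤s 1≤s | squarefree-prime* pp p∤s 1≤s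
    with squarefree s
  ... | true  = ℤP.-1*i≡-i _
  ... | false = refl

open ArithmeticFunctions

module FieldFacts {c ℓ} (F : CharZeroField c ℓ) where

  open import Data.Nat as ℕ using (ℕ; zero; suc; _≤_; z≤n)
  import Data.Nat.Properties as ℕP
  open import Data.Integer as ℤ using (ℤ; +_; -[1+_])
  import Data.Integer.Properties as ℤP
  open import Data.List using ([]; _∷_; map; foldr)
  open import Relation.Nullary using (¬_; Dec; yes; no; ¬?)
  open import Relation.Nullary.Decidable using (_×-dec_)
  open import Relation.Binary.PropositionalEquality as ≡ using (_≡_)

  open CharZeroField F
  open import Relation.Binary.Reasoning.Setoid setoid
  open import Algebra.Properties.Semiring.Mult semiring using (×-homo-+; ×1-homo-*; ×-homo-1)
  open import Algebra.Properties.Ring ring using (-0#≈0#; -‿involutive; -‿distribʳ-*; -‿+-comm; x[y-z]≈xy-xz)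
  open import Algebra.Properties.CommutativeSemigroup +-commutativeSemigroup using () renaming (interchange to +-interchange)
  open RangeSum +-commutativeMonoid using (sumBelow; when)

  fromℕ-+ : ∀ a b → fromℕ (a ℕ.+ b) ≈ fromℕ a + fromℕ b
  fromℕ-+ = ×-homo-+ 1#

  fromℕ-* : ∀ a b → fromℕ (a ℕ.* b) ≈ fromℕ a * fromℕ b
  fromℕ-* = ×1-homo-*

  fromℕ-1 : fromℕ 1 ≈ 1#
  fromℕ-1 = ×-homo-1 1#

  fromℕ-nonZero : ∀ {n} → 1 ≤ n → ¬ (fromℕ n ≈ 0#)
  fromℕ-nonZero {suc n} _ = charZero n

  fromℤ-neg : ∀ z → fromℤ (ℤ.- z) ≈ - fromℤ z
  fromℤ-neg (+ zero)   = sym -0#≈0#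
  fromℤ-neg (+ suc n)  = refl
  fromℤ-neg -[1+ n ]   = sym (-‿involutive _)

  [u+x]-[u+y] : ∀ u x y → (u + x) - (u + y) ≈ x - y
  [u+x]-[u+y] u x y = begin
    (u + x) + - (u + y)    ≈⟨ +-congˡ (sym (-‿+-comm u y)) ⟩
    (u + x) + (- u + - y)  ≈⟨ +-interchange u x (- u) (- y) ⟩
    (u - u) + (x - y)      ≈⟨ +-congʳ (-‿inverseʳ u) ⟩
    0# + (x - y)           ≈⟨ +-identityˡ _ ⟩
    x - y                  ∎

  fromℤ-⊖ : ∀ a b → fromℤ (a ℤ.⊖ b) ≈ fromℕ a - fromℕ b
  fromℤ-⊖ a zero = begin
    fromℤ (a ℤ.⊖ 0)   ≡⟨ ≡.cong fromℤ (ℤP.⊖-≥ {a} {0} z≤n) ⟩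
    fromℕ a           ≈⟨ sym (+-identityʳ _) ⟩
    fromℕ a + 0#      ≈⟨ +-congˡ (sym -0#≈0#) ⟩
    fromℕ a - 0#      ∎
  fromℤ-⊖ zero (suc b) = begin
    fromℤ (0 ℤ.⊖ suc b)   ≡⟨ ≡.cong fromℤ (ℤP.⊖-≤ {0} {suc b} z≤n) ⟩
    - fromℕ (suc b)       ≈⟨ sym (+-identityˡ _) ⟩
    0# - fromℕ (suc b)    ∎
  fromℤ-⊖ (suc a) (suc b) = begin
    fromℤ (suc a ℤ.⊖ suc b)          ≡⟨ ≡.cong fromℤ (ℤP.[1+m]⊖[1+n]≡m⊖n a b) ⟩
    fromℤ (a ℤ.⊖ b)                  ≈⟨ fromℤ-⊖ a b ⟩
    fromℕ a - fromℕ b                ≈⟨ sym ([u+x]-[u+y] 1# (fromℕ a) (fromℕ b)) ⟩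
    fromℕ (suc a) - fromℕ (suc b)    ∎

  fromℤ-+ : ∀ a b → fromℤ (a ℤ.+ b) ≈ fromℤ a + fromℤ b
  fromℤ-+ (+ m)      (+ n)      = fromℕ-+ m n
  fromℤ-+ (+ m)      -[1+ n ]   = fromℤ-⊖ m (suc n)
  fromℤ-+ -[1+ m ]   (+ n)      = trans (fromℤ-⊖ n (suc m)) (+-comm _ _)
  fromℤ-+ -[1+ m ]   -[1+ n ]   = begin
    - fromℕ (suc (suc (m ℕ.+ n)))         ≡⟨ ≡.cong (λ z → - fromℕ (suc z)) (≡.sym (ℕP.+-suc m n)) ⟩
    - fromℕ (suc m ℕ.+ suc n)             ≈⟨ -‿cong (fromℕ-+ (suc m) (suc n)) ⟩
    - (fromℕ (suc m) + fromℕ (suc n))     ≈⟨ sym (-‿+-comm _ _) ⟩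
    - fromℕ (suc m) + - fromℕ (suc n)     ∎

  fromℤ-pos* : ∀ a z → fromℤ (+ a ℤ.* z) ≈ fromℕ a * fromℤ z
  fromℤ-pos* a (+ b) = trans (reflexive (≡.cong fromℤ (≡.sym (ℤP.pos-* a b)))) (fromℕ-* a b)
  fromℤ-pos* a -[1+ b ] = begin
    fromℤ (+ a ℤ.* -[1+ b ])            ≡⟨ ≡.cong fromℤ (≡.sym (ℤP.neg-distribʳ-* (+ a) (+ suc b))) ⟩
    fromℤ (ℤ.- (+ a ℤ.* + suc b))       ≈⟨ fromℤ-neg (+ a ℤ.* + suc b) ⟩
    - fromℤ (+ a ℤ.* + suc b)           ≡⟨ ≡.cong (λ z → - fromℤ z) (≡.sym (ℤP.pos-* a (suc b))) ⟩
    - fromℕ (a ℕ.* suc b)               ≈⟨ -‿cong (fromℕ-* a (suc b)) ⟩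
    - (fromℕ a * fromℕ (suc b))         ≈⟨ -‿distribʳ-* _ _ ⟩
    fromℕ a * fromℤ -[1+ b ]            ∎

  fromℤ-sum : ∀ zs → fromℤ (foldr ℤ._+_ (+ 0) zs) ≈ ∑ (map fromℤ zs)
  fromℤ-sum []       = refl
  fromℤ-sum (z ∷ zs) = trans (fromℤ-+ z _) (+-congˡ (fromℤ-sum zs))

  inverseˡ : ∀ x → ¬ (x ≈ 0#) → (x ⁻¹) * x ≈ 1#
  inverseˡ x x≉0 = trans (*-comm _ _) (inverseʳ x x≉0)

  *-nonZero : ∀ {x y} → ¬ (x ≈ 0#) → ¬ (y ≈ 0#) → ¬ (x * y ≈ 0#)
  *-nonZero {x} {y} x≉0 y≉0 xy≈0 = y≉0 (begin
    y                ≈⟨ sym (*-identityˡ y) ⟩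
    1# * y           ≈⟨ *-congʳ (sym (inverseˡ x x≉0)) ⟩
    (x ⁻¹ * x) * y   ≈⟨ *-assoc _ _ _ ⟩
    x ⁻¹ * (x * y)   ≈⟨ *-congˡ xy≈0 ⟩
    x ⁻¹ * 0#        ≈⟨ zeroʳ _ ⟩
    0#               ∎)

  x[1-x⁻¹]≈x-1 : ∀ x → ¬ (x ≈ 0#) → x * (1# - x ⁻¹) ≈ x - 1#
  x[1-x⁻¹]≈x-1 x x≉0 = trans (x[y-z]≈xy-xz x 1# (x ⁻¹)) (+-cong (*-identityʳ x) (-‿cong (inverseʳ x x≉0)))

  sumBelow-*ˡ : ∀ N x (g : ℕ → Carrier) → sumBelow N (λ e → x * g e) ≈ x * sumBelow N g
  sumBelow-*ˡ zero    x g = sym (zeroʳ x)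
  sumBelow-*ˡ (suc N) x g = trans (+-congʳ (sumBelow-*ˡ N x g)) (sym (distribˡ x _ _))

  sumBelow-neg : ∀ N (g : ℕ → Carrier) → sumBelow N (λ e → - g e) ≈ - sumBelow N g
  sumBelow-neg zero    g = sym -0#≈0#
  sumBelow-neg (suc N) g = trans (+-congʳ (sumBelow-neg N g)) (-‿+-comm _ _)

  when-*ˡ : ∀ {P : Set} (d : Dec P) x y → when d (x * y) ≈ x * when d y
  when-*ˡ (yes _) x y = refl
  when-*ˡ (no _)  x y = sym (zeroʳ x)

  when-+-when-¬ : ∀ {P : Set} (d : Dec P) x → x ≈ when d x + when (¬? d) x
  when-+-when-¬ (yes _) x = sym (+-identityʳ x)
  when-+-when-¬ (no _)  x = sym (+-identityˡ x)

  when-×-dec : ∀ {P Q : Set} (dP : Dec P) (dQ : Dec Q) x → when (dP ×-dec dQ) x ≈ when dP (when dQ x)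
  when-×-dec (yes _) (yes _) x = refl
  when-×-dec (yes _) (no _)  x = refl
  when-×-dec (no _)  _       x = refl

module Jordan {c ℓ} (F : CharZeroField c ℓ) (k m : ℕ) .{{_ : NonZero m}} (χ : ℕ → CharZeroField.Carrier F)
              (isχ : IsDirichletCharacter F m χ) where

  open import Data.Nat as ℕ using (ℕ; zero; suc; _≤_; _<_; _^_; _∸_; NonZero)
  import Data.Nat.Properties as ℕP
  open import Data.Nat.Divisibility
  open import Data.Nat.Primality
  open import Data.Integer as ℤ using (ℤ; +_)
  open import Data.List using (filter; upTo; map; foldr; applyUpTo)
  open import Data.List.Properties using (map-∘; map-applyUpTo)
  open import Data.Nat.DivMod using (_/_; _%_; m%n<n; m≡m%n+[m/n]*n)
  open import Relation.Nullary.Decidable using (_×-dec_)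
  open import Data.Product using (_,_; proj₁)
  open import Data.Nat.GCD using (gcd)
  open import Data.Empty using (⊥-elim)
  open import Function using (_∘_)
  open import Relation.Nullary using (¬_; Dec; yes; no; ¬?)
  open import Relation.Binary.PropositionalEquality as ≡ using (_≡_; _≢_)
  open import Algebra.Properties.CommutativeSemigroup ℕP.*-commutativeSemigroup using (x∙yz≈y∙xz)

  open CharZeroField F
  open IsDirichletCharacter isχ
  open FieldFacts F
  open import Relation.Binary.Reasoning.Setoid setoid
  open RangeSum +-commutativeMonoid
  open import Algebra.Properties.Ring ring using (-0#≈0#; -‿distribʳ-*; x[y-z]≈xy-xz; [y-z]x≈yx-zx)
  open import Algebra.Solver.CommutativeMonoid *-commutativeMonoid using (solve; _⊜_; _⊕_)

  weight : ℕ → Carrier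
  weight d = χ d * fromℕ (d ^ k)

  term : ℕ → ℕ → Carrier
  term n d = χ d * (fromℕ (d ^ k) * fromℤ (μ (n ÷ d)))

  divisorTerm : ℕ → ℕ → Carrier
  divisorTerm n d = when (d ∣? n) (term n d)

  J≈sumBelow-suc : ∀ n → J F k χ n ≈ sumBelow n (divisorTerm n ∘ suc)
  J≈sumBelow-suc n = fold-filter-applyUpTo (λ e → suc e ∣? n) n (λ e → e) (term n ∘ suc)

  J≈sumBelow : ∀ {n N} → 1 ≤ n → n < N → J F k χ n ≈ sumBelow N (divisorTerm n)
  J≈sumBelow {n} 1≤n n<N = trans (J≈sumBelow-suc n) (sym (sumBelow-shift n (divisorTerm n)
    (when-no (λ 0∣n → ℕP.<⇒≢ 1≤n (≡.sym (0∣⇒≡0 0∣n))) (0 ∣? n)) n<N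
    (λ e n<e _ → when-no (λ e∣n → ℕP.<⇒≱ n<e (∣⇒≤′ 1≤n e∣n)) (e ∣? n))))

  fromℕ-^-* : ∀ a b → fromℕ ((a ℕ.* b) ^ k) ≈ fromℕ (a ^ k) * fromℕ (b ^ k)
  fromℕ-^-* a b = trans (reflexive (≡.cong fromℕ (*-^ a b k))) (fromℕ-* (a ^ k) (b ^ k))

  term-prime* : ∀ {p s y} → Prime p → 1 ≤ s → y ∣ s → term (p ℕ.* s) (p ℕ.* y) ≈ weight p * term s y
  term-prime* {p} {s} {y} pp 1≤s (divides t s≡ty) = begin
    χ (p ℕ.* y) * (fromℕ ((p ℕ.* y) ^ k) * fromℤ (μ ((p ℕ.* s) ÷ (p ℕ.* y))))
      ≡⟨ ≡.cong (λ z → χ (p ℕ.* y) * (fromℕ ((p ℕ.* y) ^ k) * fromℤ (μ z))) (÷-cancel {t = t} 1≤py ps≡t·py) ⟩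
    χ (p ℕ.* y) * (fromℕ ((p ℕ.* y) ^ k) * fromℤ (μ t))
      ≈⟨ *-cong (multiplicative p y) (*-congʳ (fromℕ-^-* p y)) ⟩
    (χ p * χ y) * ((fromℕ (p ^ k) * fromℕ (y ^ k)) * fromℤ (μ t))
      ≈⟨ solve 5 (λ a b c d e → (a ⊕ b) ⊕ ((c ⊕ d) ⊕ e) ⊜ (a ⊕ c) ⊕ (b ⊕ (d ⊕ e)))
               refl (χ p) (χ y) (fromℕ (p ^ k)) (fromℕ (y ^ k)) (fromℤ (μ t)) ⟩
    weight p * (χ y * (fromℕ (y ^ k) * fromℤ (μ t)))
      ≡⟨ ≡.cong (λ z → weight p * (χ y * (fromℕ (y ^ k) * fromℤ (μ z)))) (≡.sym (÷-cancel {t = t} 1≤y s≡ty)) ⟩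
    weight p * term s y ∎
    where
    1≤y : 1 ≤ y
    1≤y = ≥1-factorʳ {t} 1≤s s≡ty
    1≤py : 1 ≤ p ℕ.* y
    1≤py = 1≤prime*n pp 1≤y
    ps≡t·py : p ℕ.* s ≡ t ℕ.* (p ℕ.* y)
    ps≡t·py = ≡.trans (≡.cong (p ℕ.*_) s≡ty) (x∙yz≈y∙xz p t y)

  divisorTerm-prime* : ∀ {p s} y → Prime p → 1 ≤ s →
                       divisorTerm (p ℕ.* s) (p ℕ.* y) ≈ weight p * divisorTerm s y
  divisorTerm-prime* {p} {s} y pp 1≤s = trans
    (when-cong ((p ℕ.* y) ∣? (p ℕ.* s)) (y ∣? s) (*-cancelˡ-∣ p {{prime⇒nonZero pp}}) (*-monoʳ-∣ p)
               (term-prime* pp 1≤s))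
    (when-*ˡ (y ∣? s) (weight p) (term s y))

  J-prime*-split : ∀ {p s} → Prime p → 1 ≤ s →
    J F k χ (p ℕ.* s) ≈ weight p * J F k χ s + sumBelow (p ℕ.* suc s) (λ d → when (¬? (p ∣? d)) (divisorTerm (p ℕ.* s) d))
  J-prime*-split {p} {s} pp 1≤s = begin
    J F k χ ps                                                          ≈⟨ J≈sumBelow (1≤prime*n pp 1≤s) ps<N ⟩
    sumBelow N (divisorTerm ps)                                         ≈⟨ sumBelow-cong N (λ d _ → when-+-when-¬ (p ∣? d) _) ⟩
    sumBelow N (λ d → when (p ∣? d) (divisorTerm ps d) + when (¬? (p ∣? d)) (divisorTerm ps d))
                                                                        ≈⟨ sumBelow-∙ N _ _ ⟩
    sumBelow N (λ d → when (p ∣? d) (divisorTerm ps d)) + rest          ≈⟨ +-congʳ (sumBelow-multiples p (suc s) (divisorTerm ps) 1≤p) ⟩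
    sumBelow (suc s) (λ y → divisorTerm ps (p ℕ.* y)) + rest            ≈⟨ +-congʳ (sumBelow-cong (suc s) (λ y _ → divisorTerm-prime* y pp 1≤s)) ⟩
    sumBelow (suc s) (λ y → weight p * divisorTerm s y) + rest          ≈⟨ +-congʳ (sumBelow-*ˡ (suc s) (weight p) (divisorTerm s)) ⟩
    weight p * sumBelow (suc s) (divisorTerm s) + rest                  ≈⟨ +-congʳ (*-congˡ (sym (J≈sumBelow 1≤s ℕP.≤-refl))) ⟩
    weight p * J F k χ s + rest                                         ∎
    where
    ps = p ℕ.* s
    N = p ℕ.* suc s
    rest = sumBelow N (λ d → when (¬? (p ∣? d)) (divisorTerm ps d))
    1≤p : 1 ≤ p
    1≤p = prime⇒≥1 pp
    ps<N : ps < N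
    ps<N = ≡.subst (ps <_) (≡.sym (ℕP.*-suc p s)) (ℕP.m<n+m ps 1≤p)

  term-μ≡0 : ∀ {n d} → μ (n ÷ d) ≡ + 0 → term n d ≈ 0#
  term-μ≡0 {n} {d} μ≡0 = begin
    χ d * (fromℕ (d ^ k) * fromℤ (μ (n ÷ d))) ≡⟨ ≡.cong (λ z → χ d * (fromℕ (d ^ k) * fromℤ z)) μ≡0 ⟩
    χ d * (fromℕ (d ^ k) * 0#)                ≈⟨ *-congˡ (zeroʳ _) ⟩
    χ d * 0#                                  ≈⟨ zeroʳ _ ⟩
    0#                                        ∎

  term-μ-neg : ∀ {n n' d} → μ (n ÷ d) ≡ ℤ.- μ (n' ÷ d) → term n d ≈ - term n' d
  term-μ-neg {n} {n'} {d} μ≡-μ' = begin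
    χ d * (fromℕ (d ^ k) * fromℤ (μ (n ÷ d)))        ≡⟨ ≡.cong (λ z → χ d * (fromℕ (d ^ k) * fromℤ z)) μ≡-μ' ⟩
    χ d * (fromℕ (d ^ k) * fromℤ (ℤ.- μ (n' ÷ d)))   ≈⟨ *-congˡ (*-congˡ (fromℤ-neg (μ (n' ÷ d)))) ⟩
    χ d * (fromℕ (d ^ k) * - fromℤ (μ (n' ÷ d)))     ≈⟨ *-congˡ (sym (-‿distribʳ-* _ _)) ⟩
    χ d * - (fromℕ (d ^ k) * fromℤ (μ (n' ÷ d)))     ≈⟨ sym (-‿distribʳ-* _ _) ⟩
    - term n' d                                      ∎

  -- A divisor d of p·s prime to p divides s; write s = t·d, so that (p·s)/d = p·t.
  nonMultipleTerm-∣ : ∀ {p s} d → Prime p → 1 ≤ s → p ∣ s → when (¬? (p ∣? d)) (divisorTerm (p ℕ.* s) d) ≈ 0#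
  nonMultipleTerm-∣ {p} {s} d pp 1≤s p∣s with p ∣? d | d ∣? (p ℕ.* s)
  ... | yes _   | _       = refl
  ... | no _    | no _    = refl
  ... | no p∤d  | yes d∣ps with ∣prime*⇒∣ pp p∤d d∣ps
  ...   | divides t s≡td = term-μ≡0 (≡.trans (≡.cong μ (÷-cancel {t = p ℕ.* t} 1≤d ps≡pt·d))
                                             (μ-square p (1≤prime*n pp 1≤t) (prime⇒≥2 pp) (*-monoʳ-∣ p p∣t)))
    where
    1≤d = ≥1-factorʳ {t} 1≤s s≡td
    1≤t = ≥1-factorˡ {t} 1≤s s≡td
    ps≡pt·d : p ℕ.* s ≡ p ℕ.* t ℕ.* d
    ps≡pt·d = ≡.trans (≡.cong (p ℕ.*_) s≡td) (≡.sym (ℕP.*-assoc p t d))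
    p∣t : p ∣ t
    p∣t = prime∤⇒∣ʳ pp p∤d (≡.subst (p ∣_) (≡.trans s≡td (ℕP.*-comm t d)) p∣s)

  nonMultipleTerm-∤ : ∀ {p s} d → Prime p → 1 ≤ s → ¬ p ∣ s →
                      when (¬? (p ∣? d)) (divisorTerm (p ℕ.* s) d) ≈ - divisorTerm s d
  nonMultipleTerm-∤ {p} {s} d pp 1≤s p∤s with p ∣? d | d ∣? (p ℕ.* s) | d ∣? s
  ... | yes p∣d | _        | yes d∣s = ⊥-elim (p∤s (∣-trans p∣d d∣s))
  ... | yes _   | _        | no _    = sym -0#≈0#
  ... | no _    | no ¬d∣ps | yes d∣s = ⊥-elim (¬d∣ps (∣-trans d∣s (n∣m*n p)))
  ... | no _    | no _     | no _    = sym -0#≈0#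
  ... | no p∤d  | yes d∣ps | no ¬d∣s = ⊥-elim (¬d∣s (∣prime*⇒∣ pp p∤d d∣ps))
  ... | no p∤d  | yes _    | yes (divides t s≡td) =
    term-μ-neg (≡.trans (≡.cong μ (÷-cancel {t = p ℕ.* t} 1≤d ps≡pt·d))
               (≡.trans (μ-prime* pp p∤t 1≤t) (≡.cong (λ z → ℤ.- μ z) (≡.sym (÷-cancel {t = t} 1≤d s≡td)))))
    where
    1≤d = ≥1-factorʳ {t} 1≤s s≡td
    1≤t = ≥1-factorˡ {t} 1≤s s≡td
    ps≡pt·d : p ℕ.* s ≡ p ℕ.* t ℕ.* d
    ps≡pt·d = ≡.trans (≡.cong (p ℕ.*_) s≡td) (≡.sym (ℕP.*-assoc p t d))
    p∤t : ¬ p ∣ t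
    p∤t p∣t = p∤s (≡.subst (p ∣_) (≡.sym s≡td) (∣-trans p∣t (m∣m*n d)))

  J-prime*-∣ : ∀ {p s} → Prime p → 1 ≤ s → p ∣ s → J F k χ (p ℕ.* s) ≈ weight p * J F k χ s
  J-prime*-∣ {p} {s} pp 1≤s p∣s = begin
    J F k χ (p ℕ.* s)                     ≈⟨ J-prime*-split pp 1≤s ⟩
    weight p * J F k χ s + sumBelow (p ℕ.* suc s) _
                                          ≈⟨ +-congˡ (sumBelow-ε (p ℕ.* suc s) _ (λ d _ → nonMultipleTerm-∣ d pp 1≤s p∣s)) ⟩
    weight p * J F k χ s + 0#             ≈⟨ +-identityʳ _ ⟩
    weight p * J F k χ s                  ∎

  J-prime*-∤ : ∀ {p s} → Prime p → 1 ≤ s → ¬ p ∣ s → J F k χ (p ℕ.* s) ≈ (weight p - 1#) * J F k χ s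
  J-prime*-∤ {p} {s} pp 1≤s p∤s = begin
    J F k χ (p ℕ.* s)                                  ≈⟨ J-prime*-split pp 1≤s ⟩
    weight p * J F k χ s + sumBelow N _                ≈⟨ +-congˡ (sumBelow-cong N (λ d _ → nonMultipleTerm-∤ d pp 1≤s p∤s)) ⟩
    weight p * J F k χ s + sumBelow N (λ d → - divisorTerm s d)
                                                       ≈⟨ +-congˡ (sumBelow-neg N (divisorTerm s)) ⟩
    weight p * J F k χ s - sumBelow N (divisorTerm s)  ≈⟨ +-congˡ (-‿cong (sym (J≈sumBelow 1≤s s<N))) ⟩
    weight p * J F k χ s - J F k χ s                   ≈⟨ +-congˡ (-‿cong (sym (*-identityˡ _))) ⟩
    weight p * J F k χ s - 1# * J F k χ s              ≈⟨ sym ([y-z]x≈yx-zx _ _ _) ⟩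
    (weight p - 1#) * J F k χ s                        ∎
    where
    N = p ℕ.* suc s
    s<N : s < N
    s<N = ℕP.<-≤-trans (ℕP.n<1+n s) (n≤prime*n (suc s) pp)

  module Π = RangeSum *-commutativeMonoid
  open PrimeDivisorFold *-commutativeMonoid using (fold-primeDivisors-prime*)

  localFactor₁ : ℕ → ℕ → Carrier
  localFactor₁ n p = (χ p ^ᴿ (expo p n ∸ 1)) * (χ p - (fromℕ (p ^ k)) ⁻¹)

  closedForm₁ : ℕ → Carrier
  closedForm₁ n = fromℕ (n ^ k) * ∏ (map (localFactor₁ n) (primeDivisors n))

  localFactor₂ : ℕ → Carrier
  localFactor₂ p = 1# - weight p ⁻¹

  closedForm₂ : ℕ → Carrier
  closedForm₂ n = (fromℕ (n ^ k) * χ n) * ∏ (map localFactor₂ (primeDivisors n))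

  p^k≉0 : ∀ {p} → Prime p → ¬ (fromℕ (p ^ k) ≈ 0#)
  p^k≉0 {p} pp = fromℕ-nonZero (ℕP.m^n>0 p {{prime⇒nonZero pp}} k)

  localFactor₁-coprime : ∀ {p s} q → Prime p → 1 ≤ s → Prime q → q ≢ p → localFactor₁ (p ℕ.* s) q ≈ localFactor₁ s q
  localFactor₁-coprime {p} {s} q pp 1≤s pq q≢p = reflexive (≡.cong (λ e → (χ q ^ᴿ (e ∸ 1)) * (χ q - (fromℕ (q ^ k)) ⁻¹))
    (expo-coprime* pq (distinctPrimes-∤ pp pq q≢p) (prime⇒≥1 pp) 1≤s))

  closedForm₁-prime*-∣ : ∀ {p s} → Prime p → 1 ≤ s → p ∣ s → closedForm₁ (p ℕ.* s) ≈ weight p * closedForm₁ s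
  closedForm₁-prime*-∣ {p} {s} pp 1≤s p∣s@(divides t s≡tp) = begin
    fromℕ ((p ℕ.* s) ^ k) * ∏ (map (localFactor₁ (p ℕ.* s)) (primeDivisors (p ℕ.* s)))
      ≈⟨ *-cong (fromℕ-^-* p s) (fold-primeDivisors-prime* _ _ (χ p) pp 1≤s
                   (λ q pq _ q≢p → localFactor₁-coprime q pp 1≤s pq q≢p) atp) ⟩
    (fromℕ (p ^ k) * fromℕ (s ^ k)) * (χ p * ∏ (map (localFactor₁ s) (primeDivisors s)))
      ≈⟨ solve 4 (λ a b c d → (a ⊕ b) ⊕ (c ⊕ d) ⊜ (c ⊕ a) ⊕ (b ⊕ d)) refl (fromℕ (p ^ k)) (fromℕ (s ^ k)) (χ p) _ ⟩
    weight p * closedForm₁ s ∎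
    where
    expo-s : expo p s ≡ suc (expo p t)
    expo-s = ≡.trans (≡.cong (expo p) (≡.trans s≡tp (ℕP.*-comm t p))) (expo-prime* pp (≥1-factorˡ {t} 1≤s s≡tp))
    expo-ps : expo p (p ℕ.* s) ∸ 1 ≡ suc (expo p s ∸ 1)
    expo-ps = ≡.trans (≡.cong (_∸ 1) (expo-prime* pp 1≤s)) (≡.trans expo-s (≡.cong (λ e → suc (e ∸ 1)) (≡.sym expo-s)))
    atp : localFactor₁ (p ℕ.* s) p ≈ χ p * Π.when (p ∣? s) (localFactor₁ s p)
    atp = trans (reflexive (≡.cong (λ e → (χ p ^ᴿ e) * (χ p - (fromℕ (p ^ k)) ⁻¹)) expo-ps))
                (trans (*-assoc _ _ _) (*-congˡ (sym (Π.when-yes p∣s (p ∣? s)))))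

  closedForm₁-prime*-∤ : ∀ {p s} → Prime p → 1 ≤ s → ¬ p ∣ s → closedForm₁ (p ℕ.* s) ≈ (weight p - 1#) * closedForm₁ s
  closedForm₁-prime*-∤ {p} {s} pp 1≤s p∤s = begin
    fromℕ ((p ℕ.* s) ^ k) * ∏ (map (localFactor₁ (p ℕ.* s)) (primeDivisors (p ℕ.* s)))
      ≈⟨ *-cong (fromℕ-^-* p s) (fold-primeDivisors-prime* _ _ x pp 1≤s
                   (λ q pq _ q≢p → localFactor₁-coprime q pp 1≤s pq q≢p) atp) ⟩
    (fromℕ (p ^ k) * fromℕ (s ^ k)) * (x * ∏ (map (localFactor₁ s) (primeDivisors s)))
      ≈⟨ solve 4 (λ a b c d → (a ⊕ b) ⊕ (c ⊕ d) ⊜ (a ⊕ c) ⊕ (b ⊕ d)) refl (fromℕ (p ^ k)) (fromℕ (s ^ k)) x _ ⟩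
    (fromℕ (p ^ k) * x) * closedForm₁ s
      ≈⟨ *-congʳ (trans (x[y-z]≈xy-xz _ _ _) (+-cong (*-comm _ _) (-‿cong (inverseʳ _ (p^k≉0 pp))))) ⟩
    (weight p - 1#) * closedForm₁ s ∎
    where
    x = χ p - (fromℕ (p ^ k)) ⁻¹
    atp : localFactor₁ (p ℕ.* s) p ≈ x * Π.when (p ∣? s) (localFactor₁ s p)
    atp = begin
      (χ p ^ᴿ (expo p (p ℕ.* s) ∸ 1)) * x  ≡⟨ ≡.cong (λ e → (χ p ^ᴿ (e ∸ 1)) * x) (≡.trans (expo-prime* pp 1≤s) (≡.cong suc (expo-∤ p∤s))) ⟩
      1# * x                              ≈⟨ *-comm _ _ ⟩
      x * 1#                              ≈⟨ *-congˡ (sym (Π.when-no p∤s (p ∣? s))) ⟩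
      x * Π.when (p ∣? s) (localFactor₁ s p) ∎

  closedForm₂-prime*-∣ : ∀ {p s} → Prime p → 1 ≤ s → p ∣ s → closedForm₂ (p ℕ.* s) ≈ weight p * closedForm₂ s
  closedForm₂-prime*-∣ {p} {s} pp 1≤s p∣s = begin
    (fromℕ ((p ℕ.* s) ^ k) * χ (p ℕ.* s)) * ∏ (map localFactor₂ (primeDivisors (p ℕ.* s)))
      ≈⟨ *-cong (*-cong (fromℕ-^-* p s) (multiplicative p s))
                (fold-primeDivisors-prime* _ _ 1# pp 1≤s (λ _ _ _ _ → refl)
                   (trans (sym (*-identityˡ _)) (*-congˡ (sym (Π.when-yes p∣s (p ∣? s)))))) ⟩
    ((fromℕ (p ^ k) * fromℕ (s ^ k)) * (χ p * χ s)) * (1# * ∏ (map localFactor₂ (primeDivisors s)))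
      ≈⟨ *-congˡ (*-identityˡ _) ⟩
    ((fromℕ (p ^ k) * fromℕ (s ^ k)) * (χ p * χ s)) * ∏ (map localFactor₂ (primeDivisors s))
      ≈⟨ solve 5 (λ a b c d e → ((a ⊕ b) ⊕ (c ⊕ d)) ⊕ e ⊜ (c ⊕ a) ⊕ ((b ⊕ d) ⊕ e)) refl (fromℕ (p ^ k)) (fromℕ (s ^ k)) (χ p) (χ s) _ ⟩
    weight p * closedForm₂ s ∎

  closedForm₂-prime*-∤ : ∀ {p s} → Prime p → 1 ≤ s → ¬ p ∣ s → ¬ (χ p ≈ 0#) →
                         closedForm₂ (p ℕ.* s) ≈ (weight p - 1#) * closedForm₂ s
  closedForm₂-prime*-∤ {p} {s} pp 1≤s p∤s χp≉0 = begin
    (fromℕ ((p ℕ.* s) ^ k) * χ (p ℕ.* s)) * ∏ (map localFactor₂ (primeDivisors (p ℕ.* s)))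
      ≈⟨ *-cong (*-cong (fromℕ-^-* p s) (multiplicative p s))
                (fold-primeDivisors-prime* _ _ (localFactor₂ p) pp 1≤s (λ _ _ _ _ → refl)
                   (trans (sym (*-identityʳ _)) (*-congˡ (sym (Π.when-no p∤s (p ∣? s)))))) ⟩
    ((fromℕ (p ^ k) * fromℕ (s ^ k)) * (χ p * χ s)) * (localFactor₂ p * ∏ (map localFactor₂ (primeDivisors s)))
      ≈⟨ solve 6 (λ a b c d e g → ((a ⊕ b) ⊕ (c ⊕ d)) ⊕ (e ⊕ g) ⊜ ((c ⊕ a) ⊕ e) ⊕ ((b ⊕ d) ⊕ g))
               refl (fromℕ (p ^ k)) (fromℕ (s ^ k)) (χ p) (χ s) (localFactor₂ p) _ ⟩
    (weight p * localFactor₂ p) * closedForm₂ s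
      ≈⟨ *-congʳ (x[1-x⁻¹]≈x-1 (weight p) (*-nonZero χp≉0 (p^k≉0 pp))) ⟩
    (weight p - 1#) * closedForm₂ s ∎

  fromℕ-1^k : fromℕ (1 ^ k) ≈ 1#
  fromℕ-1^k = trans (reflexive (≡.cong fromℕ (ℕP.^-zeroˡ k))) fromℕ-1

  J-1 : J F k χ 1 ≈ 1#
  J-1 = begin
    J F k χ 1                                   ≈⟨ J≈sumBelow-suc 1 ⟩
    0# + divisorTerm 1 1                        ≈⟨ +-identityˡ _ ⟩
    divisorTerm 1 1                             ≈⟨ when-yes ∣-refl (1 ∣? 1) ⟩
    χ 1 * (fromℕ (1 ^ k) * fromℤ (+ 1))         ≈⟨ *-cong one (*-cong fromℕ-1^k fromℕ-1) ⟩
    1# * (1# * 1#)                              ≈⟨ trans (*-identityˡ _) (*-identityˡ _) ⟩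
    1#                                          ∎

  J≈closedForm₁ : ∀ n → 1 ≤ n → J F k χ n ≈ closedForm₁ n
  J≈closedForm₁ = primeInduction (λ n → J F k χ n ≈ closedForm₁ n) J1≈ step
    where
    J1≈ : J F k χ 1 ≈ closedForm₁ 1
    J1≈ = trans J-1 (sym (trans (*-congʳ fromℕ-1^k) (*-identityˡ _)))
    step : ∀ {p s} → Prime p → 1 ≤ s → J F k χ s ≈ closedForm₁ s → J F k χ (p ℕ.* s) ≈ closedForm₁ (p ℕ.* s)
    step {p} {s} pp 1≤s J≈ with p ∣? s
    ... | yes p∣s = trans (J-prime*-∣ pp 1≤s p∣s) (trans (*-congˡ J≈) (sym (closedForm₁-prime*-∣ pp 1≤s p∣s)))
    ... | no p∤s  = trans (J-prime*-∤ pp 1≤s p∤s) (trans (*-congˡ J≈) (sym (closedForm₁-prime*-∤ pp 1≤s p∤s)))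

  J≈closedForm₂ : ∀ n → 1 ≤ n → gcd n m ≡ 1 → J F k χ n ≈ closedForm₂ n
  J≈closedForm₂ = primeInduction (λ n → gcd n m ≡ 1 → J F k χ n ≈ closedForm₂ n) J1≈ step
    where
    J1≈ : gcd 1 m ≡ 1 → J F k χ 1 ≈ closedForm₂ 1
    J1≈ _ = trans J-1 (sym (trans (*-congʳ (*-cong fromℕ-1^k one)) (trans (*-identityʳ _) (*-identityˡ _))))
    step : ∀ {p s} → Prime p → 1 ≤ s → (gcd s m ≡ 1 → J F k χ s ≈ closedForm₂ s) →
           gcd (p ℕ.* s) m ≡ 1 → J F k χ (p ℕ.* s) ≈ closedForm₂ (p ℕ.* s)
    step {p} {s} pp 1≤s J≈ coprime with J≈ (gcd≡1-∣ {s} {p ℕ.* s} {m} (n∣m*n p) coprime) | p ∣? s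
    ... | J≈′ | yes p∣s = trans (J-prime*-∣ pp 1≤s p∣s) (trans (*-congˡ J≈′) (sym (closedForm₂-prime*-∣ pp 1≤s p∣s)))
    ... | J≈′ | no p∤s  = trans (J-prime*-∤ pp 1≤s p∤s) (trans (*-congˡ J≈′) (sym (closedForm₂-prime*-∤ pp 1≤s p∤s χp≉0)))
      where
      χp≉0 : ¬ (χ p ≈ 0#)
      χp≉0 χp≈0 = proj₁ (zero-iff p) χp≈0 (gcd≡1-∣ {p} {p ℕ.* s} {m} (m∣m*n s) coprime)

  χ-+* : ∀ r q → χ (r ℕ.+ q ℕ.* m) ≈ χ r
  χ-+* r zero    = reflexive (≡.cong χ (ℕP.+-identityʳ r))
  χ-+* r (suc q) = begin
    χ (r ℕ.+ (m ℕ.+ q ℕ.* m))  ≡⟨ ≡.cong χ (≡.trans (≡.cong (r ℕ.+_) (ℕP.+-comm m (q ℕ.* m))) (≡.sym (ℕP.+-assoc r (q ℕ.* m) m))) ⟩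
    χ (r ℕ.+ q ℕ.* m ℕ.+ m)    ≈⟨ periodic _ ⟩
    χ (r ℕ.+ q ℕ.* m)          ≈⟨ χ-+* r q ⟩
    χ r                        ∎

  χ-% : ∀ a → χ (a % m) ≈ χ a
  χ-% a = trans (sym (χ-+* (a % m) (a / m))) (reflexive (≡.cong χ (≡.sym (m≡m%n+[m/n]*n a m))))

  sumBelow-residue : ∀ d {P : Set} (D : Dec P) x →
    sumBelow m (λ j → when (D ×-dec (d % m ℕ.≟ j)) (χ j * x)) ≈ when D (χ d * x)
  sumBelow-residue d (no ¬P) x = sumBelow-ε m _ (λ j _ → when-×-dec (no ¬P) (d % m ℕ.≟ j) (χ j * x))
  sumBelow-residue d (yes P) x = begin
    sumBelow m (λ j → when (yes P ×-dec (d % m ℕ.≟ j)) (χ j * x))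
      ≈⟨ sumBelow-cong m (λ j _ → trans (when-×-dec (yes P) (d % m ℕ.≟ j) _)
           (when-cong (d % m ℕ.≟ j) (d % m ℕ.≟ j) (λ eq → eq) (λ eq → eq)
              (λ d%m≡j → *-congʳ (trans (reflexive (≡.cong χ (≡.sym d%m≡j))) (χ-% d))))) ⟩
    sumBelow m (λ j → when (d % m ℕ.≟ j) (χ d * x))  ≈⟨ sumBelow-delta m (d % m) (χ d * x) (m%n<n d m) ⟩
    χ d * x                                          ∎

  fromℤ-Jmod : ∀ n j → fromℤ (Jmod k j m n) ≈
    sumBelow n (λ e → when ((suc e ∣? n) ×-dec (suc e % m ℕ.≟ j)) (fromℕ (suc e ^ k) * fromℤ (μ (n / suc e))))
  fromℤ-Jmod n j = begin
    fromℤ (foldr ℤ._+_ (+ 0) (map g (filter D (upTo n))))  ≈⟨ fromℤ-sum (map g (filter D (upTo n))) ⟩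
    ∑ (map fromℤ (map g (filter D (upTo n))))              ≡⟨ ≡.cong ∑ (≡.sym (map-∘ (filter D (upTo n)))) ⟩
    ∑ (map (fromℤ ∘ g) (filter D (upTo n)))                ≈⟨ fold-filter-applyUpTo D n (λ e → e) (fromℤ ∘ g) ⟩
    sumBelow n (λ e → when (D e) (fromℤ (g e)))
      ≈⟨ sumBelow-cong n (λ e _ → when-cong (D e) (D e) (λ x → x) (λ x → x) (λ _ → fromℤ-pos* (suc e ^ k) (μ (n / suc e)))) ⟩
    sumBelow n (λ e → when (D e) (fromℕ (suc e ^ k) * fromℤ (μ (n / suc e)))) ∎
    where
    D = λ e → (suc e ∣? n) ×-dec (suc e % m ℕ.≟ j)
    g : ℕ → ℤ
    g e = + (suc e ^ k) ℤ.* μ (n / suc e)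

  J≈∑Jmod : ∀ n → J F k χ n ≈ ∑ (map (λ j → χ j * fromℤ (Jmod k j m n)) (upTo m))
  J≈∑Jmod n = sym (begin
    ∑ (map (λ j → χ j * fromℤ (Jmod k j m n)) (upTo m))        ≡⟨ ≡.cong ∑ (map-applyUpTo (λ j → j) _ m) ⟩
    ∑ (applyUpTo (λ j → χ j * fromℤ (Jmod k j m n)) m)          ≈⟨ fold-applyUpTo m _ ⟩
    sumBelow m (λ j → χ j * fromℤ (Jmod k j m n))               ≈⟨ sumBelow-cong m (λ j _ → *-congˡ (fromℤ-Jmod n j)) ⟩
    sumBelow m (λ j → χ j * sumBelow n (λ e → when (D j e) (X e)))
      ≈⟨ sumBelow-cong m (λ j _ → trans (sym (sumBelow-*ˡ n (χ j) _)) (sumBelow-cong n (λ e _ → sym (when-*ˡ (D j e) (χ j) (X e))))) ⟩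
    sumBelow m (λ j → sumBelow n (λ e → when (D j e) (χ j * X e))) ≈⟨ sumBelow-swap m n _ ⟩
    sumBelow n (λ e → sumBelow m (λ j → when (D j e) (χ j * X e))) ≈⟨ sumBelow-cong n (λ e _ → sumBelow-residue (suc e) (suc e ∣? n) (X e)) ⟩
    sumBelow n (divisorTerm n ∘ suc)                                ≈⟨ sym (J≈sumBelow-suc n) ⟩
    J F k χ n                                                       ∎)
    where
    X : ℕ → Carrier
    X e = fromℕ (suc e ^ k) * fromℤ (μ (n / suc e))
    D = λ j e → (suc e ∣? n) ×-dec (suc e % m ℕ.≟ j)

lemma2p1 : ∀ {c ℓ} (F : CharZeroField c ℓ) → let open CharZeroField F in
    (k m : ℕ) .{{_ : NonZero m}} (χ : ℕ → Carrier) → IsDirichletCharacter F m χ →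
      (∀ n → 1 ≤ n →
         J F k χ n ≈ (fromℕ (n ^ k) * ∏ (map (λ p → (χ p ^ᴿ (expo p n ∸ 1)) * (χ p - (fromℕ (p ^ k)) ⁻¹))
                                             (primeDivisors n))))
    × (∀ n → 1 ≤ n → gcd n m ≡ 1 →
         J F k χ n ≈ ((fromℕ (n ^ k) * χ n) * ∏ (map (λ p → 1# - (χ p * fromℕ (p ^ k)) ⁻¹)
                                                    (primeDivisors n))))
    × (∀ n → 1 ≤ n →
         J F k χ n ≈ ∑ (map (λ j → χ j * fromℤ (Jmod k j m n)) (upTo m)))
lemma2p1 F k m χ isχ = J≈closedForm₁ , J≈closedForm₂ , λ n _ → J≈∑Jmod n
  where open Jordan F k m χ isχ
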